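{- If $G$ and $H$ are two $k$-uniform $r$-regular hypergraphs with $n$ vertices, then $G\cong_f H$.
   Context: A hypergraph $G=(V,X)$ consists of a finite vertex set $V$ and a family $X$ of subsets of $V$ (hyperedges). It is $k$-uniform if all hyperedges have cardinality $k$, and $r$-regular if every vertex belongs to exactly $r$ hyperedges. If $G$ has $n$ vertices and $m\ge1$ hyperedges, its vertex-hyperedge incidence matrix $M_G\in\{0,1\}^{n\times m}$ has $(i,j)$ entry $1$ iff vertex $i$ belongs to hyperedge $j$. A doubly stochastic matrix is a square nonnegative matrix whose rows and columns each sum to $1$. $G\cong_f H$ means: either $G$ and $H$ have the same number of vertices and no hyperedges, or there exist doubly stochastic matrices $S_1,S_2$ with $S_1M_G=M_HS_2^t$ and $M_GS_2=S_1^tM_H$. -}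

module Defs where

open import Data.Nat using (ℕ; zero; suc; _≥_)
import Data.Nat as ℕ
open import Data.Fin using (Fin; zero; suc)
open import Data.Fin.Subset using (Subset; _∈_; ∣_∣; Nonempty)
open import Data.Fin.Subset.Properties using (_∈?_)
open import Data.Rational using (ℚ; 0ℚ; 1ℚ; _+_; _*_; _≤_)
open import Data.Product using (Σ; _×_)
open import Data.Sum using (_⊎_)
open import Data.Bool using (if_then_else_)
open import Relation.Nullary using (does)
open import Relation.Binary.PropositionalEquality using (_≡_; subst)

sumℚ : ∀ {k} → (Fin k → ℚ) → ℚ
sumℚ {zero}  f = 0ℚ
sumℚ {suc k} f = f zero + sumℚ (λ i → f (suc i))

sumℕ : ∀ {k} → (Fin k → ℕ) → ℕ
sumℕ {zero}  f = 0
sumℕ {suc k} f = f zero ℕ.+ sumℕ (λ i → f (suc i))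

Matrix : ℕ → ℕ → Set
Matrix a b = Fin a → Fin b → ℚ

_·_ : ∀ {a b c} → Matrix a b → Matrix b c → Matrix a c
(A · B) i j = sumℚ (λ l → A i l * B l j)

_ᵗ : ∀ {a b} → Matrix a b → Matrix b a
(A ᵗ) i j = A j i

DoublyStochastic : ∀ {a} → Matrix a a → Set
DoublyStochastic {a} S =
  (∀ i j → 0ℚ ≤ S i j) × (∀ i → sumℚ (λ j → S i j) ≡ 1ℚ) × (∀ j → sumℚ (λ i → S i j) ≡ 1ℚ)

-- A hypergraph on the vertex set Fin n: a family of m hyperedges, each a
-- (nonempty) subset of the vertices. Repeated hyperedges are allowed.
record Hypergraph (n : ℕ) : Set where
  field
    m        : ℕ
    edge     : Fin m → Subset n
    nonempty : ∀ j → Nonempty (edge j)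
open Hypergraph public

Uniform : ∀ {n} → ℕ → Hypergraph n → Set
Uniform k G = ∀ j → ∣ edge G j ∣ ≡ k

degree : ∀ {n} → Hypergraph n → Fin n → ℕ
degree G i = sumℕ (λ j → if does (i ∈? edge G j) then 1 else 0)

Regular : ∀ {n} → ℕ → Hypergraph n → Set
Regular r G = ∀ i → degree G i ≡ r

incidence : ∀ {n} (G : Hypergraph n) → Matrix n (m G)
incidence G i j = if does (i ∈? edge G j) then 1ℚ else 0ℚ

-- In the second case the shape constraints force m G ≡ m H; H's hyperedge
-- indices are transported along that equality.
_≅f_ : ∀ {n} → Hypergraph n → Hypergraph n → Set
_≅f_ {n} G H =
  (m G ≡ 0 × m H ≡ 0)
  ⊎ (m G ≥ 1 × Σ (m G ≡ m H) λ q →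
      Σ (Matrix n n) λ S₁ → Σ (Matrix (m G) (m G)) λ S₂ →
        DoublyStochastic S₁ × DoublyStochastic S₂ ×
        (∀ i j → (S₁ · incidence G) i j ≡ ((λ a b → incidence H a (subst Fin q b)) · (S₂ ᵗ)) i j) ×
        (∀ i j → (incidence G · S₂) i j ≡ ((S₁ ᵗ) · (λ a b → incidence H a (subst Fin q b))) i j))

-- Double counting incidences gives m k = n r; as edges are nonempty, k ≥ 1 once there is an
-- edge, so G and H have the same number m of hyperedges. Every row of an incidence matrix sums
-- to r and every column to k, hence J/n · M_G and M_H · (J/m)ᵗ are both the constant matrix
-- k/n = r/m, and likewise M_G · J/m = (J/n)ᵗ · M_H = r/m. So the uniform doubly stochastic
-- matrices S₁ = J/n and S₂ = J/m witness G ≅f H.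
module Submission where

open import Defs
open import Data.Bool using (Bool; true; false; if_then_else_)
open import Data.Empty using (⊥-elim)
open import Data.Fin using (Fin; zero; suc; fromℕ<)
open import Data.Fin.Properties using (nonZeroIndex)
open import Data.Fin.Subset using (Subset; inside; outside; ∣_∣; Nonempty)
open import Data.Fin.Subset.Properties using (_∈?_; x∈p⇒∣p-x∣<∣p∣)
open import Data.Nat using (ℕ; zero; suc; _<_; NonZero; ≢-nonZero)
import Data.Nat as ℕ
import Data.Nat.Properties as ℕ
open import Data.Product using (_×_; _,_; proj₁)
open import Data.Rational using (ℚ; 0ℚ; 1ℚ; _+_; _*_; 1/_; NonNegative; Positive)
import Data.Rational as ℚ
import Data.Rational.Properties as ℚ
open import Data.Rational.Solver using (module +-*-Solver)
open import Data.Sum using (inj₁; inj₂)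
open import Data.Vec using (_∷_; [])
open import Function using (_∘_)
open import Relation.Nullary using (¬_; does; yes; no)
open import Relation.Binary.PropositionalEquality
open ≡-Reasoning

open import Algebra.Bundles using (Ring)
import Algebra.Properties.Semiring.Mult (Ring.semiring ℚ.+-*-ring) as ℚ×
import Algebra.Properties.CommutativeMonoid.Sum ℕ.+-0-commutativeMonoid as ℕΣ

fromℕ : ℕ → ℚ
fromℕ a = a ℚ×.× 1ℚ

fromℕ-+ : ∀ a b → fromℕ (a ℕ.+ b) ≡ fromℕ a + fromℕ b
fromℕ-+ = ℚ×.×-homo-+ 1ℚ

fromℕ-* : ∀ a b → fromℕ (a ℕ.* b) ≡ fromℕ a * fromℕ b
fromℕ-* = ℚ×.×1-homo-*

fromℕ-nonNeg : ∀ a → NonNegative (fromℕ a)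
fromℕ-nonNeg zero    = _
fromℕ-nonNeg (suc a) = ℚ.nonNeg+nonNeg⇒nonNeg 1ℚ (fromℕ a) {{fromℕ-nonNeg a}}

fromℕ-pos : ∀ a .{{_ : NonZero a}} → Positive (fromℕ a)
fromℕ-pos (suc a) = ℚ.pos+nonNeg⇒pos 1ℚ (fromℕ a) {{fromℕ-nonNeg a}}

fromℕ-nonZero : ∀ a .{{_ : NonZero a}} → ℚ.NonZero (fromℕ a)
fromℕ-nonZero a = ℚ.pos⇒nonZero (fromℕ a) {{fromℕ-pos a}}

fromℕ⁻¹ : ∀ a .{{_ : NonZero a}} → ℚ
fromℕ⁻¹ a = (1/ fromℕ a) {{fromℕ-nonZero a}}

fromℕ-inverseʳ : ∀ a .{{_ : NonZero a}} → fromℕ a * fromℕ⁻¹ a ≡ 1ℚ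
fromℕ-inverseʳ a = ℚ.*-inverseʳ (fromℕ a) {{fromℕ-nonZero a}}

0≤fromℕ⁻¹ : ∀ a .{{_ : NonZero a}} → 0ℚ ℚ.≤ fromℕ⁻¹ a
0≤fromℕ⁻¹ a = ℚ.nonNegative⁻¹ (fromℕ⁻¹ a) {{ℚ.pos⇒nonNeg (fromℕ⁻¹ a) {{fromℕ⁻¹-pos}}}}
  where
  fromℕ⁻¹-pos : Positive (fromℕ⁻¹ a)
  fromℕ⁻¹-pos = ℚ.1/pos⇒pos (fromℕ a) {{fromℕ-pos a}}

fromℕ-ratio : ∀ m n {k r} .{{_ : NonZero m}} .{{_ : NonZero n}} → m ℕ.* k ≡ n ℕ.* r →
  fromℕ⁻¹ n * fromℕ k ≡ fromℕ r * fromℕ⁻¹ m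
fromℕ-ratio m n {k} {r} mk≡nr = begin
  n⁻¹ * K             ≡⟨ ℚ.*-identityʳ (n⁻¹ * K) ⟨
  n⁻¹ * K * 1ℚ        ≡⟨ cong (n⁻¹ * K *_) (fromℕ-inverseʳ m) ⟨
  n⁻¹ * K * (M * m⁻¹) ≡⟨ S.solve 4 (λ n⁻¹ K M m⁻¹ → n⁻¹ S.:* K S.:* (M S.:* m⁻¹)
                                     S.:= n⁻¹ S.:* (M S.:* K) S.:* m⁻¹) refl n⁻¹ K M m⁻¹ ⟩
  n⁻¹ * (M * K) * m⁻¹ ≡⟨ cong (λ x → n⁻¹ * x * m⁻¹) MK≡NR ⟩
  n⁻¹ * (N * R) * m⁻¹ ≡⟨ S.solve 4 (λ n⁻¹ N R m⁻¹ → n⁻¹ S.:* (N S.:* R) S.:* m⁻¹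
                                     S.:= N S.:* n⁻¹ S.:* (R S.:* m⁻¹)) refl n⁻¹ N R m⁻¹ ⟩
  N * n⁻¹ * (R * m⁻¹) ≡⟨ cong (_* (R * m⁻¹)) (fromℕ-inverseʳ n) ⟩
  1ℚ * (R * m⁻¹)      ≡⟨ ℚ.*-identityˡ (R * m⁻¹) ⟩
  R * m⁻¹             ∎
  where
  module S = +-*-Solver
  M = fromℕ m
  N = fromℕ n
  K = fromℕ k
  R = fromℕ r
  m⁻¹ = fromℕ⁻¹ m
  n⁻¹ = fromℕ⁻¹ n
  MK≡NR : M * K ≡ N * R
  MK≡NR = trans (sym (fromℕ-* m k)) (trans (cong fromℕ mk≡nr) (fromℕ-* n r))

sumℚ-const : ∀ a x → sumℚ {a} (λ _ → x) ≡ fromℕ a * x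
sumℚ-const zero    x = sym (ℚ.*-zeroˡ x)
sumℚ-const (suc a) x = begin
  x + sumℚ {a} (λ _ → x)  ≡⟨ cong₂ _+_ (sym (ℚ.*-identityˡ x)) (sumℚ-const a x) ⟩
  1ℚ * x + fromℕ a * x    ≡⟨ ℚ.*-distribʳ-+ x 1ℚ (fromℕ a) ⟨
  fromℕ (suc a) * x       ∎

sumℚ-*ˡ : ∀ {a} c (f : Fin a → ℚ) → sumℚ (λ l → c * f l) ≡ c * sumℚ f
sumℚ-*ˡ {zero}  c f = sym (ℚ.*-zeroʳ c)
sumℚ-*ˡ {suc _} c f =
  trans (cong (c * f zero +_) (sumℚ-*ˡ c (f ∘ suc))) (sym (ℚ.*-distribˡ-+ c (f zero) _))

sumℚ-*ʳ : ∀ {a} c (f : Fin a → ℚ) → sumℚ (λ l → f l * c) ≡ sumℚ f * c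
sumℚ-*ʳ {zero}  c f = sym (ℚ.*-zeroˡ c)
sumℚ-*ʳ {suc _} c f =
  trans (cong (f zero * c +_) (sumℚ-*ʳ c (f ∘ suc))) (sym (ℚ.*-distribʳ-+ c (f zero) _))

indicator : Bool → ℕ
indicator b = if b then 1 else 0

sumℚ-indicator : ∀ {a} (b : Fin a → Bool) →
  sumℚ (λ l → if b l then 1ℚ else 0ℚ) ≡ fromℕ (sumℕ (indicator ∘ b))
sumℚ-indicator {zero}  b = refl
sumℚ-indicator {suc _} b = begin
  (if b zero then 1ℚ else 0ℚ) + sumℚ (λ l → if b (suc l) then 1ℚ else 0ℚ)
    ≡⟨ cong₂ _+_ (fromℕ-indicator (b zero)) (sumℚ-indicator (b ∘ suc)) ⟩
  fromℕ (indicator (b zero)) + fromℕ (sumℕ (indicator ∘ b ∘ suc))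
    ≡⟨ fromℕ-+ (indicator (b zero)) _ ⟨
  fromℕ (sumℕ (indicator ∘ b)) ∎
  where
  fromℕ-indicator : ∀ c → (if c then 1ℚ else 0ℚ) ≡ fromℕ (indicator c)
  fromℕ-indicator true  = refl
  fromℕ-indicator false = refl

sumℕ-const : ∀ a x → sumℕ {a} (λ _ → x) ≡ a ℕ.* x
sumℕ-const zero    x = refl
sumℕ-const (suc a) x = cong (x ℕ.+_) (sumℕ-const a x)

sumℕ-cong : ∀ {a} {f g : Fin a → ℕ} → (∀ i → f i ≡ g i) → sumℕ f ≡ sumℕ g
sumℕ-cong {zero}  e = refl
sumℕ-cong {suc _} e = cong₂ ℕ._+_ (e zero) (sumℕ-cong (e ∘ suc))

sumℕ≡∑ : ∀ {a} (f : Fin a → ℕ) → sumℕ f ≡ ℕΣ.sum f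
sumℕ≡∑ {zero}  f = refl
sumℕ≡∑ {suc _} f = cong (f zero ℕ.+_) (sumℕ≡∑ (f ∘ suc))

sumℕ-comm : ∀ {a b} (f : Fin a → Fin b → ℕ) →
  sumℕ (λ i → sumℕ (f i)) ≡ sumℕ (λ j → sumℕ (λ i → f i j))
sumℕ-comm f = begin
  sumℕ (λ i → sumℕ (f i))                ≡⟨ sumℕ²≡∑² f ⟩
  ℕΣ.sum (λ i → ℕΣ.sum (f i))            ≡⟨ ℕΣ.∑-comm f ⟩
  ℕΣ.sum (λ j → ℕΣ.sum (λ i → f i j))    ≡⟨ sumℕ²≡∑² (λ j i → f i j) ⟨
  sumℕ (λ j → sumℕ (λ i → f i j))        ∎
  where
  sumℕ²≡∑² : ∀ {a b} (g : Fin a → Fin b → ℕ) →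
    sumℕ (λ i → sumℕ (g i)) ≡ ℕΣ.sum (λ i → ℕΣ.sum (g i))
  sumℕ²≡∑² g = trans (sumℕ≡∑ (λ i → sumℕ (g i))) (ℕΣ.sum-cong-≗ (λ i → sumℕ≡∑ (g i)))

uniformMatrix : ∀ a .{{_ : NonZero a}} → Matrix a a
uniformMatrix a _ _ = fromℕ⁻¹ a

uniformMatrix-doublyStochastic : ∀ a .{{_ : NonZero a}} → DoublyStochastic (uniformMatrix a)
uniformMatrix-doublyStochastic a = (λ _ _ → 0≤fromℕ⁻¹ a) , (λ _ → sum≡1) , (λ _ → sum≡1)
  where
  sum≡1 : sumℚ {a} (λ _ → fromℕ⁻¹ a) ≡ 1ℚ
  sum≡1 = trans (sumℚ-const a _) (fromℕ-inverseʳ a)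

RowSums : ∀ {a b} → Matrix a b → ℚ → Set
RowSums A ρ = ∀ i → sumℚ (A i) ≡ ρ

ColSums : ∀ {a b} → Matrix a b → ℚ → Set
ColSums A κ = ∀ j → sumℚ (λ i → A i j) ≡ κ

RowSums-subst : ∀ {a b c} (q : c ≡ b) (A : Matrix a b) {ρ} →
  RowSums A ρ → RowSums (λ i l → A i (subst Fin q l)) ρ
RowSums-subst refl A rows = rows

ColSums-subst : ∀ {a b c} (q : c ≡ b) (A : Matrix a b) {κ} →
  ColSums A κ → ColSums (λ i l → A i (subst Fin q l)) κ
ColSums-subst refl A cols = cols

const-·-colSums : ∀ {a b c} (A : Matrix b c) {κ} x → ColSums A κ →
  ∀ i j → ((λ (_ : Fin a) (_ : Fin b) → x) · A) i j ≡ x * κ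
const-·-colSums A x cols i j = trans (sumℚ-*ˡ x (λ l → A l j)) (cong (x *_) (cols j))

·-const-rowSums : ∀ {a b c} (A : Matrix a b) {ρ} x → RowSums A ρ →
  ∀ i j → (A · (λ (_ : Fin b) (_ : Fin c) → x)) i j ≡ ρ * x
·-const-rowSums A x rows i j = trans (sumℚ-*ʳ x (A i)) (cong (_* x) (rows i))

uniformMatrix-intertwines : ∀ {a b} .{{_ : NonZero a}} .{{_ : NonZero b}} {ρ κ} (A B : Matrix a b) →
  fromℕ⁻¹ a * κ ≡ ρ * fromℕ⁻¹ b →
  ColSums A κ → RowSums A ρ → ColSums B κ → RowSums B ρ →
  (∀ i j → (uniformMatrix a · A) i j ≡ (B · (uniformMatrix b ᵗ)) i j) ×
  (∀ i j → (A · uniformMatrix b) i j ≡ ((uniformMatrix a ᵗ) · B) i j)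
uniformMatrix-intertwines {a} {b} {ρ} {κ} A B ratio colsA rowsA colsB rowsB = first , second
  where
  first : ∀ i j → (uniformMatrix a · A) i j ≡ (B · (uniformMatrix b ᵗ)) i j
  first i j = begin
    (uniformMatrix a · A) i j           ≡⟨ const-·-colSums A (fromℕ⁻¹ a) colsA i j ⟩
    fromℕ⁻¹ a * κ                       ≡⟨ ratio ⟩
    ρ * fromℕ⁻¹ b                       ≡⟨ ·-const-rowSums B (fromℕ⁻¹ b) rowsB i j ⟨
    (B · (uniformMatrix b ᵗ)) i j       ∎
  second : ∀ i j → (A · uniformMatrix b) i j ≡ ((uniformMatrix a ᵗ) · B) i j
  second i j = begin
    (A · uniformMatrix b) i j           ≡⟨ ·-const-rowSums A (fromℕ⁻¹ b) rowsA i j ⟩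
    ρ * fromℕ⁻¹ b                       ≡⟨ ratio ⟨
    fromℕ⁻¹ a * κ                       ≡⟨ const-·-colSums B (fromℕ⁻¹ a) colsB i j ⟨
    ((uniformMatrix a ᵗ) · B) i j       ∎

sum-indicator≡∣p∣ : ∀ {n} (p : Subset n) → sumℕ (λ i → indicator (does (i ∈? p))) ≡ ∣ p ∣
sum-indicator≡∣p∣ []            = refl
sum-indicator≡∣p∣ (inside  ∷ p) = cong suc (sum-indicator≡∣p∣ p)
sum-indicator≡∣p∣ (outside ∷ p) = sum-indicator≡∣p∣ p

nonempty⇒∣p∣>0 : ∀ {n} {p : Subset n} → Nonempty p → 0 < ∣ p ∣
nonempty⇒∣p∣>0 (_ , x∈p) = ℕ.m<n⇒0<n (x∈p⇒∣p-x∣<∣p∣ x∈p)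

¬Fin⇒≡0 : ∀ {a} → ¬ Fin a → a ≡ 0
¬Fin⇒≡0 {zero}  _   = refl
¬Fin⇒≡0 {suc _} ¬fin = ⊥-elim (¬fin zero)

module _ {n : ℕ} (G : Hypergraph n) where

  handshake : ∀ {k r} → Uniform k G → Regular r G → m G ℕ.* k ≡ n ℕ.* r
  handshake {k} {r} uniform regular = begin
    m G ℕ.* k                           ≡⟨ sumℕ-const (m G) k ⟨
    sumℕ {m G} (λ _ → k)                ≡⟨ sumℕ-cong edgeSize ⟨
    sumℕ (λ j → sumℕ (λ i → χ i j))     ≡⟨ sumℕ-comm χ ⟨
    sumℕ (degree G)                     ≡⟨ sumℕ-cong regular ⟩
    sumℕ {n} (λ _ → r)                  ≡⟨ sumℕ-const n r ⟩
    n ℕ.* r                             ∎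
    where
    χ : Fin n → Fin (m G) → ℕ
    χ i j = indicator (does (i ∈? edge G j))
    edgeSize : ∀ j → sumℕ (λ i → χ i j) ≡ k
    edgeSize j = trans (sum-indicator≡∣p∣ (edge G j)) (uniform j)

  uniform⇒edgeSize>0 : ∀ {k} → Uniform k G → Fin (m G) → 0 < k
  uniform⇒edgeSize>0 uniform j = subst (0 <_) (uniform j) (nonempty⇒∣p∣>0 (nonempty G j))

  uniform₀⇒edgeless : Uniform 0 G → m G ≡ 0
  uniform₀⇒edgeless uniform = ¬Fin⇒≡0 (λ j → ℕ.<-irrefl refl (uniform⇒edgeSize>0 uniform j))

  incidence-rowSum : ∀ {r} → Regular r G → RowSums (incidence G) (fromℕ r)
  incidence-rowSum regular i =
    trans (sumℚ-indicator (λ j → does (i ∈? edge G j))) (cong fromℕ (regular i))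

  incidence-colSum : ∀ {k} → Uniform k G → ColSums (incidence G) (fromℕ k)
  incidence-colSum uniform j =
    trans (sumℚ-indicator (λ i → does (i ∈? edge G j)))
          (cong fromℕ (trans (sum-indicator≡∣p∣ (edge G j)) (uniform j)))

edgeCount-unique : ∀ {n k r} (G H : Hypergraph n) →
  Uniform k G → Regular r G → Uniform k H → Regular r H → m G ≡ m H
edgeCount-unique {k = zero} G H uG _ uH _ =
  trans (uniform₀⇒edgeless G uG) (sym (uniform₀⇒edgeless H uH))
edgeCount-unique {k = suc _} G H uG rG uH rH =
  ℕ.*-cancelʳ-≡ (m G) (m H) _ (trans (handshake G uG rG) (sym (handshake H uH rH)))

mainTheorem10 : (n k r : ℕ) (G H : Hypergraph n) →
    Uniform k G → Regular r G → Uniform k H → Regular r H → G ≅f H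
mainTheorem10 n k r G H uG rG uH rH with m G ℕ.≟ 0
... | yes noEdge = inj₁ (noEdge , trans (sym (edgeCount-unique G H uG rG uH rH)) noEdge)
... | no someEdge =
  inj₂ (ℕ.n≢0⇒n>0 someEdge , q , uniformMatrix n , uniformMatrix (m G)
       , uniformMatrix-doublyStochastic n , uniformMatrix-doublyStochastic (m G)
       , uniformMatrix-intertwines (incidence G) (λ i l → incidence H i (subst Fin q l))
           (fromℕ-ratio (m G) n (handshake G uG rG))
           (incidence-colSum G uG) (incidence-rowSum G rG)
           (ColSums-subst q (incidence H) (incidence-colSum H uH))
           (RowSums-subst q (incidence H) (incidence-rowSum H rH)))
  where
  q : m G ≡ m H
  q = edgeCount-unique G H uG rG uH rH
  instance
    _ : NonZero (m G)
    _ = ≢-nonZero someEdge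
    _ : NonZero n
    _ = nonZeroIndex (proj₁ (nonempty G (fromℕ< (ℕ.n≢0⇒n>0 someEdge))))
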